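{- Let $m,n\geq 3$ be integers and $D=\overrightarrow{C}_m[\overrightarrow{C}_n]$. For any complete coloring of $D$ with $k$ colors, \[k\leq \max\{\min\{f_n(x),g_n(x)\}: x\in\mathbb{N},\ x\geq 1\},\] where $f_n(x)=\lfloor mn/x\rfloor$ and $g_n(x)=x(n+1)+1$.
   Context: $\overrightarrow{C}_m$ is the directed cycle with vertex set $\mathbb{Z}_m$ and arcs $j\to j+1$. The lexicographic product $D[H]$ has vertex set $V(D)\times V(H)$, with an arc from $(u,a)$ to $(v,b)$ iff $uv\in A(D)$, or $u=v$ and $ab\in A(H)$. A coloring with $k$ colors is a surjection $V(D)\to[k]$ that is proper (each color class spans no arc); it is complete if for every ordered pair $(i,j)$ of distinct colors there is at least one arc from a vertex colored $i$ to a vertex colored $j$. -}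

module Defs where

open import Data.Nat using (ℕ; suc; _*_; _/_; _+_)
open import Data.Nat.Properties using ()
open import Data.Fin using (Fin; toℕ)
open import Data.Product using (_×_; ∃; ∃-syntax; _,_)
open import Data.Sum using (_⊎_)
open import Relation.Binary.PropositionalEquality using (_≡_; _≢_)

record Digraph : Set₁ where
  field
    V   : Set
    Arc : V → V → Set
open Digraph public

-- Directed cycle C⃗_m on ℤ_m ≅ Fin m, arcs j → j+1 (mod m).
CycleArc : (m : ℕ) → Fin m → Fin m → Set
CycleArc m u v = (suc (toℕ u) ≡ toℕ v) ⊎ ((suc (toℕ u) ≡ m) × (toℕ v ≡ 0))

Cycle : ℕ → Digraph
Cycle m = record { V = Fin m ; Arc = CycleArc m }

Lex : Digraph → Digraph → Digraph
Lex D H = record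
  { V = V D × V H
  ; Arc = λ { (u , a) (v , b) → Arc D u v ⊎ ((u ≡ v) × Arc H a b) } }

IsColoring : (D : Digraph) (k : ℕ) → (V D → Fin k) → Set
IsColoring D k c =
  (∀ (i : Fin k) → ∃[ v ] c v ≡ i)
  × (∀ (u v : V D) → Arc D u v → c u ≢ c v)

IsComplete : (D : Digraph) (k : ℕ) → (V D → Fin k) → Set
IsComplete D k c =
  ∀ (i j : Fin k) → i ≢ j →
    ∃[ u ] ∃[ v ] (Arc D u v × c u ≡ i × c v ≡ j)

IsCompleteColoring : (D : Digraph) (k : ℕ) → (V D → Fin k) → Set
IsCompleteColoring D k c = IsColoring D k c × IsComplete D k c

f : (m n x : ℕ) → .{{_ : Data.Nat.NonZero x}} → ℕ
f m n x = (m * n) / x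

g : (n x : ℕ) → ℕ
g n x = x * (n + 1) + 1

-- Let S be a smallest colour class and s = |S| ≥ 1; the k classes partition the mn
-- vertices, so ks ≤ mn.  Every vertex of C⃗_m[C⃗_n] has out-degree n + 1, and by
-- completeness each of the other k − 1 colours occurs on an out-neighbour of S, so
-- k − 1 ≤ s(n + 1).  Hence x = s bounds k by both f_n(x) and g_n(x).
module Submission where

open import Defs
open import Data.Empty using (⊥-elim)
open import Data.Fin using (Fin; toℕ; punchIn; combine; remQuot; _≟_)
  renaming (zero to fzero; suc to fsuc)
open import Data.Fin.Properties
  using (toℕ-injective; toℕ<n; ¬Fin0; suc-injective; punchInᵢ≢i; punchIn-injective;
         combine-injective; remQuot-combine; injective⇒≤)
open import Data.List using (List; []; _∷_; [_]; length; map; filter; allFin; lookup)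
open import Data.List.Properties using (length-map; length-tabulate; length-++; filter-++;
  filter-accept; filter-reject)
open import Data.List.Membership.Propositional using (_∈_)
open import Data.List.Membership.Propositional.Properties
  using (∈-map⁺; ∈-allFin; ∈-filter⁺; ∈-length)
open import Data.List.Relation.Unary.Any using (index)
open import Data.List.Relation.Unary.Any.Properties using (lookup-index)
open import Data.Nat using (ℕ; zero; suc; _+_; _*_; _≤_; _<_; _⊓_; z≤n; s≤s)
open import Data.Nat.DivMod using (m*n/n≡m; /-monoˡ-≤)
open import Data.Nat.Properties
  using (+-0-commutativeMonoid; +-comm; ≤-refl; ≤-trans; <⇒≤; ≰⇒>; _≤?_; +-mono-≤;
         <-irrefl; ⊓-glb)
open import Data.Product using (_×_; ∃-syntax; _,_; proj₂)
open import Data.Sum using (inj₁; inj₂)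
open import Function using (_∘_; Injective)
open import Relation.Nullary using (yes; no)
open import Relation.Binary.PropositionalEquality
  using (_≡_; _≢_; refl; sym; trans; cong; cong₂; subst; module ≡-Reasoning)

open import Algebra.Properties.CommutativeMonoid.Sum +-0-commutativeMonoid
  using (sum-syntax; sum-cong-≗; sum-remove; sum-replicate-zero; ∑-distrib-+)

Functional : Digraph → Set
Functional D = ∀ {u v w} → Arc D u v → Arc D u w → v ≡ w

last-has-no-successor : ∀ {m} {u v : Fin m} → suc (toℕ u) ≡ m → suc (toℕ u) ≢ toℕ v
last-has-no-successor {v = v} u-last u→v = <-irrefl (trans (sym u→v) u-last) (toℕ<n v)

cycle-functional : ∀ m → Functional (Cycle m)
cycle-functional m (inj₁ u→v) (inj₁ u→w) = toℕ-injective (trans (sym u→v) u→w)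
cycle-functional m (inj₁ u→v) (inj₂ (u-last , _)) = ⊥-elim (last-has-no-successor u-last u→v)
cycle-functional m (inj₂ (u-last , _)) (inj₁ u→w) = ⊥-elim (last-has-no-successor u-last u→w)
cycle-functional m (inj₂ (_ , v≡0)) (inj₂ (_ , w≡0)) = toℕ-injective (trans v≡0 (sym w≡0))

record OutDegreeAtMost (D : Digraph) (d : ℕ) : Set where
  field
    label           : ∀ {u v} → Arc D u v → Fin d
    label-injective : ∀ {u v w} (p : Arc D u v) (q : Arc D u w) → label p ≡ label q → v ≡ w

lex-outDegree : ∀ {D} n → Functional D → OutDegreeAtMost (Lex D (Cycle n)) (suc n)
lex-outDegree {D} n D-functional = record { label = label ; label-injective = label-injective }
  where
  label : ∀ {x y} → Arc (Lex D (Cycle n)) x y → Fin (suc n)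
  label {y = _ , b} (inj₁ _) = fsuc b
  label             (inj₂ _) = fzero

  label-injective : ∀ {x y z} (p : Arc (Lex D (Cycle n)) x y) (q : Arc (Lex D (Cycle n)) x z) →
                    label p ≡ label q → y ≡ z
  label-injective (inj₁ u→v) (inj₁ u→w) b≡b′ = cong₂ _,_ (D-functional u→v u→w) (suc-injective b≡b′)
  label-injective (inj₂ (refl , a→b)) (inj₂ (refl , a→b′)) _ = cong (_ ,_) (cycle-functional n a→b a→b′)

ReachedFrom : ∀ (D : Digraph) {k} → (V D → Fin k) → List (V D) → Fin k → Set
ReachedFrom D c S j = ∃[ u ] ∃[ v ] (u ∈ S × Arc D u v × c v ≡ j)

module _ {D : Digraph} {d k : ℕ} (Δ : OutDegreeAtMost D d) (c : V D → Fin (suc k))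
         (S : List (V D)) where

  open OutDegreeAtMost Δ

  encode : ∀ {j} → ReachedFrom D c S j → Fin (length S * d)
  encode (_ , _ , u∈S , u→v , _) = combine (index u∈S) (label u→v)

  encode-injective : ∀ {j j′} (r : ReachedFrom D c S j) (r′ : ReachedFrom D c S j′) →
                     encode r ≡ encode r′ → j ≡ j′
  encode-injective (u , v , u∈S , u→v , refl) (u′ , v′ , u′∈S , u′→v′ , refl) code≡
    with index≡ , label≡ ← combine-injective _ _ _ _ code≡
    with refl ← trans (lookup-index u∈S) (trans (cong (lookup S) index≡) (sym (lookup-index u′∈S)))
    = cong c (label-injective u→v u′→v′ label≡)

  colours-reachedFrom-≤ : (i : Fin (suc k)) → (∀ j → i ≢ j → ReachedFrom D c S j) →
                          k ≤ length S * d
  colours-reachedFrom-≤ i reach = injective⇒≤ {f = encode ∘ reach′} encode∘reach′-injective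
    where
    reach′ : (j : Fin k) → ReachedFrom D c S (punchIn i j)
    reach′ j = reach (punchIn i j) (punchInᵢ≢i i j ∘ sym)

    encode∘reach′-injective : Injective _≡_ _≡_ (encode ∘ reach′)
    encode∘reach′-injective {j} {j′} =
      punchIn-injective i j j′ ∘ encode-injective (reach′ j) (reach′ j′)

colourClass : ∀ {A : Set} {k} → (A → Fin k) → Fin k → List A → List A
colourClass c i = filter (λ v → c v ≟ i)

∑-length-colourClass-singleton : ∀ {A : Set} {k} (c : A → Fin k) x →
                                 ∑[ i < k ] length (colourClass c i [ x ]) ≡ 1
∑-length-colourClass-singleton {k = zero}  c x = ⊥-elim (¬Fin0 (c x))
∑-length-colourClass-singleton {k = suc k} c x = begin
  ∑[ i < suc k ] length (colourClass c i [ x ])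
    ≡⟨ sum-remove {i = c x} (λ i → length (colourClass c i [ x ])) ⟩
  length (colourClass c (c x) [ x ]) + ∑[ j < k ] length (colourClass c (punchIn (c x) j) [ x ])
    ≡⟨ cong₂ _+_ (cong length (filter-accept (λ v → c v ≟ c x) refl))
                 (sum-cong-≗ λ j → cong length
                   (filter-reject (λ v → c v ≟ punchIn (c x) j) (punchInᵢ≢i (c x) j ∘ sym))) ⟩
  1 + ∑[ j < k ] 0
    ≡⟨ cong suc (sum-replicate-zero k) ⟩
  1 ∎
  where open ≡-Reasoning

∑-length-colourClass : ∀ {A : Set} {k} (c : A → Fin k) xs →
                       ∑[ i < k ] length (colourClass c i xs) ≡ length xs
∑-length-colourClass {k = k} c []       = sum-replicate-zero k
∑-length-colourClass {k = k} c (x ∷ xs) = begin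
  ∑[ i < k ] length (colourClass c i (x ∷ xs))
    ≡⟨ sum-cong-≗ (λ i → trans (cong length (filter-++ (λ v → c v ≟ i) [ x ] xs))
                                (length-++ (colourClass c i [ x ]))) ⟩
  ∑[ i < k ] (length (colourClass c i [ x ]) + length (colourClass c i xs))
    ≡⟨ ∑-distrib-+ (λ i → length (colourClass c i [ x ])) (λ i → length (colourClass c i xs)) ⟩
  ∑[ i < k ] length (colourClass c i [ x ]) + ∑[ i < k ] length (colourClass c i xs)
    ≡⟨ cong₂ _+_ (∑-length-colourClass-singleton c x) (∑-length-colourClass c xs) ⟩
  suc (length xs) ∎
  where open ≡-Reasoning

∃-minimum : ∀ {k} (a : Fin (suc k) → ℕ) → ∃[ i ] (∀ j → a i ≤ a j)
∃-minimum {zero}  a = fzero , λ { fzero → ≤-refl }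
∃-minimum {suc k} a with ∃-minimum (a ∘ fsuc)
... | i , a∘fsuc-min with a fzero ≤? a (fsuc i)
...   | yes a₀≤aᵢ = fzero , λ { fzero → ≤-refl ; (fsuc j) → ≤-trans a₀≤aᵢ (a∘fsuc-min j) }
...   | no  a₀≰aᵢ = fsuc i , λ { fzero → <⇒≤ (≰⇒> a₀≰aᵢ) ; (fsuc j) → a∘fsuc-min j }

*-≤-∑ : ∀ {k x} (a : Fin k → ℕ) → (∀ j → x ≤ a j) → k * x ≤ ∑[ j < k ] a j
*-≤-∑ {zero}  a x≤a = z≤n
*-≤-∑ {suc k} a x≤a = +-mono-≤ (x≤a fzero) (*-≤-∑ (a ∘ fsuc) (x≤a ∘ fsuc))

∃-small-colourClass : ∀ {A : Set} {k} (c : A → Fin (suc k)) xs →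
                      ∃[ i ] (suc k * length (colourClass c i xs) ≤ length xs)
∃-small-colourClass {k = k} c xs = smallest-class (∃-minimum classSize)
  where
  classSize : Fin (suc k) → ℕ
  classSize j = length (colourClass c j xs)

  smallest-class : ∃[ i ] (∀ j → classSize i ≤ classSize j) → ∃[ i ] (suc k * classSize i ≤ length xs)
  smallest-class (i , smallest) =
    i , subst (suc k * classSize i ≤_) (∑-length-colourClass c xs) (*-≤-∑ classSize smallest)

allPairs : ∀ m n → List (Fin m × Fin n)
allPairs m n = map (remQuot n) (allFin (m * n))

length-allPairs : ∀ m n → length (allPairs m n) ≡ m * n
length-allPairs m n =
  trans (length-map (remQuot {m} n) (allFin (m * n))) (length-tabulate {n = m * n} (λ t → t))

∈-allPairs : ∀ {m n} (v : Fin m × Fin n) → v ∈ allPairs m n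
∈-allPairs {n = n} (u , a) =
  subst (_∈ _) (remQuot-combine u a) (∈-map⁺ (remQuot n) (∈-allFin (combine u a)))

∃-≤-f⊓g : ∀ m n k s → 0 < s → k * s ≤ m * n → k ≤ suc (s * suc n) →
          ∃[ x ] (k ≤ f m n (suc x) ⊓ g n (suc x))
∃-≤-f⊓g m n k (suc s) _ k*s≤mn k≤s[n+1]+1 = s , ⊓-glb k≤f k≤g
  where
  k≤f : k ≤ f m n (suc s)
  k≤f = subst (_≤ f m n (suc s)) (m*n/n≡m k (suc s)) (/-monoˡ-≤ (suc s) k*s≤mn)

  k≤g : k ≤ g n (suc s)
  k≤g = subst (k ≤_) (trans (cong (λ t → suc (suc s * t)) (+-comm 1 n)) (+-comm 1 _)) k≤s[n+1]+1

theorem7 : (m n : ℕ) → 3 ≤ m → 3 ≤ n →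
    (k : ℕ) (c : V (Lex (Cycle m) (Cycle n)) → Fin k) →
    IsCompleteColoring (Lex (Cycle m) (Cycle n)) k c →
    ∃[ x ] (k ≤ f m n (suc x) ⊓ g n (suc x))
theorem7 m n _ _ zero    c _ = 0 , z≤n
theorem7 m n _ _ (suc k) c ((surjective , _) , complete)
  with i , k*s≤|V| ← ∃-small-colourClass c (allPairs m n) =
  ∃-≤-f⊓g m n (suc k) (length S) (∈-length (∈-S (proj₂ (surjective i))))
    (subst (suc k * length S ≤_) (length-allPairs m n) k*s≤|V|)
    (s≤s (colours-reachedFrom-≤ (lex-outDegree n (cycle-functional m)) c S i reach))
  where
  S : List (Fin m × Fin n)
  S = colourClass c i (allPairs m n)

  ∈-S : ∀ {v} → c v ≡ i → v ∈ S
  ∈-S {v} = ∈-filter⁺ (λ w → c w ≟ i) (∈-allPairs v)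

  reach : ∀ j → i ≢ j → ReachedFrom (Lex (Cycle m) (Cycle n)) c S j
  reach j i≢j with u , v , u→v , cu≡i , cv≡j ← complete i j i≢j = u , v , ∈-S cu≡i , u→v , cv≡j
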